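{- Let $G$ be a finite abelian group of order $n$, let $L$ be a $d$-dimensional Latin hypercube of order $n$ indexed by $G$, let $d'>d$, and let $P_1,\dots,P_m$ be $k$-planes of $L$. Suppose that every $(G,d')$-suitable diagonal of $L$ contains an entry of $P_1\cup\cdots\cup P_m$. Then every transversal of the $d'$-dimensional $G$-extension $L'$ of $L$ contains an entry of $P'_1\cup\cdots\cup P'_m$, where $P'_i=\pi^{ -1}(P_i)$ is a $(k+d'-d)$-plane of $L'$ for $1\le i\le m$.
   Context: A $d$-dimensional hypercube of order $n$ indexed by $G$ is a map $H:G^d\to G$ with entries $(x_1,\dots,x_d;H(x_1,\dots,x_d))$. A $k$-plane is the set of entries whose coordinates lie in $J_1\times\cdots\times J_d$ where each $J_i$ is either a singleton or all of $G$, with exactly $k$ of them equal to $G$; a line is a $1$-plane and a hyperplane a $(d-1)$-plane. $H$ is Latin if every line contains every element of $G$ as a symbol. A diagonal is a set of $n$ entries no two agreeing in any coordinate; a transversal is a diagonal with pairwise distinct symbols. For an entry $e=(x_1,\dots,x_d;\sigma)$, $\Delta(e)=\sigma-x_1-\cdots-x_d$; $G_+$ is the sum of all elements of $G$. A diagonal $D$ of $L$ is $(G,d')$-suitable if $\sum_{e\in D}\Delta(e)=(1-d')G_+$. The $d'$-dimensional $G$-extension of $L$ is $L'(x_1,\dots,x_{d'})=L(x_1,\dots,x_d)+\sum_{i=d+1}^{d'}x_i$, and $\pi$ maps the entry of $L'$ at $(x_1,\dots,x_{d'})$ to the entry of $L$ at $(x_1,\dots,x_d)$. -}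

module Defs where

open import Data.Nat using (ℕ; zero; suc; _+_; _≤_; _<_; _∸_; _≤?_)
open import Data.Fin using (Fin; toℕ; fromℕ<; inject≤; _≟_)
open import Data.Fin.Properties using ()
open import Data.Maybe using (Maybe; just; nothing)
open import Data.List using (List; foldr; map)
open import Data.List using () renaming (allFin to allFinL)
open import Data.Product using (Σ; ∃; ∃-syntax; _×_; _,_)
open import Data.Bool using (if_then_else_)
open import Relation.Nullary using (yes; no; ¬_)
open import Relation.Nullary.Decidable using (⌊_⌋)
open import Relation.Binary.PropositionalEquality using (_≡_)
open import Function.Definitions using (Injective)

countFree : ∀ {d} {A : Set} → (Fin d → Maybe A) → ℕ
countFree {zero} J = 0
countFree {suc d} J with J Fin.zero
... | nothing = suc (countFree (λ i → J (Fin.suc i)))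
... | just _  = countFree (λ i → J (Fin.suc i))
  where import Data.Fin as Fin

-- Everything is relative to a group whose carrier is Fin n (order n),
-- given by its operation _+_, identity ε and inverse -_.
module Cube {n : ℕ} (_+_ : Fin n → Fin n → Fin n) (ε : Fin n) (-_ : Fin n → Fin n) where

  Σ[_] : ∀ {m} → (Fin m → Fin n) → Fin n
  Σ[ f ] = foldr _+_ ε (map f (allFinL _))

  _·_ : ℕ → Fin n → Fin n
  zero · g = ε
  suc k · g = g + (k · g)

  G₊ : Fin n
  G₊ = Σ[ (λ g → g) ]

  Hypercube : ℕ → Set
  Hypercube d = (Fin d → Fin n) → Fin n

  _[_≔_] : ∀ {d} → (Fin d → Fin n) → Fin d → Fin n → (Fin d → Fin n)
  (x [ i ≔ a ]) j with i ≟ j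
  ... | yes _ = a
  ... | no _  = x j

  IsLatin : ∀ {d} → Hypercube d → Set
  IsLatin {d} H = ∀ (i : Fin d) (x : Fin d → Fin n) (s : Fin n) →
                  ∃[ a ] H (x [ i ≔ a ]) ≡ s

  -- A diagonal: n entries (given by their positions D j, entry (D j ; H (D j)))
  -- no two agreeing in any coordinate.
  IsDiagonal : ∀ {d} → (Fin n → (Fin d → Fin n)) → Set
  IsDiagonal {d} D = ∀ (i : Fin d) → Injective _≡_ _≡_ (λ j → D j i)

  IsTransversal : ∀ {d} → Hypercube d → (Fin n → (Fin d → Fin n)) → Set
  IsTransversal H D = IsDiagonal D × Injective _≡_ _≡_ (λ j → H (D j))

  Δ : ∀ {d} → Hypercube d → (Fin d → Fin n) → Fin n
  Δ H x = H x + (- Σ[ x ])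

  IsSuitable : ∀ {d} → ℕ → Hypercube d → (Fin n → (Fin d → Fin n)) → Set
  IsSuitable d' H D = IsDiagonal D × (Σ[ (λ j → Δ H (D j)) ] ≡ G₊ + (- (d' · G₊)))

  -- A plane is specified by J : Fin d → Maybe G (nothing = all of G, just a = {a});
  -- it is a k-plane when exactly k coordinates are free.
  IsPlane : ∀ {d} → ℕ → (Fin d → Maybe (Fin n)) → Set
  IsPlane k J = countFree J ≡ k

  InPlane : ∀ {d} → (Fin d → Maybe (Fin n)) → (Fin d → Fin n) → Set
  InPlane {d} J x = ∀ (i : Fin d) (a : Fin n) → J i ≡ just a → x i ≡ a

  -- restriction of a d'-position to its first d coordinates (π on positions)
  restrict : ∀ {d d'} → d ≤ d' → (Fin d' → Fin n) → (Fin d → Fin n)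
  restrict d≤d' x i = x (inject≤ i d≤d')

  extension : ∀ {d} (d' : ℕ) → d ≤ d' → Hypercube d → Hypercube d'
  extension {d} d' d≤d' L x =
    L (restrict d≤d' x) + Σ[ (λ i → if ⌊ d ≤? toℕ i ⌋ then x i else ε) ]

{-# OPTIONS --safe #-}
-- For an entry of the G-extension L', the extra coordinates are added to the symbol and
-- subtracted again in Δ, so Δ(e) = Δ(π e). If D' is a transversal of L', its symbols and each
-- of its d' coordinates run through all of G, hence the Δ-values of D' sum to G₊ − d'·G₊.
-- Thus π(D') is a (G,d')-suitable diagonal of L and meets some P_i, i.e. D' meets
-- P'_i = π⁻¹(P_i), which is the plane P_i with the d' − d new coordinates left free.
module Submission where

open import Defs
open import Data.Nat using (ℕ; _≤_; _<_; _+_; _∸_)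
open import Data.Nat.Properties using (<⇒≤)
open import Data.Fin using (Fin)
open import Data.Maybe using (Maybe)
open import Data.Product using (∃-syntax; _×_)
open import Relation.Binary.PropositionalEquality using (_≡_)
open import Algebra.Structures using (IsAbelianGroup)
open import Function.Bundles using (_⇔_)

open import Data.Nat using (zero; suc; z≤n; s≤s; s≤s⁻¹; _≤?_)
open import Data.Nat.Properties using (1+n≰n)
open import Data.Fin using (zero; suc; toℕ; inject≤; punchOut; _≟_)
open import Data.Fin.Properties using (any?; punchOut-injective; injective⇒≤)
open import Data.Fin.Permutation using (Permutation; permutation; _⟨$⟩ʳ_)
open import Data.Maybe using (just; nothing)
import Data.List as List
open import Data.List.Properties using (map-tabulate)
import Data.Vec.Functional as Vector
open import Data.Product using (_,_; proj₁; proj₂)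
open import Data.Bool using (if_then_else_)
open import Relation.Nullary using (yes; no)
open import Relation.Nullary.Decidable using (Dec; ⌊_⌋; does-⇔; isYes≗does)
open import Relation.Nullary.Negation using (contradiction)
open import Relation.Binary.PropositionalEquality
  using (refl; sym; trans; cong; cong₂; module ≡-Reasoning)
open import Function using (_∘_; id; case_of_)
open import Function.Bundles using (mk⇔)
open import Function.Definitions using (Injective; Surjective)
open import Algebra.Bundles using (AbelianGroup; CommutativeMonoid)

foldr-tabulate : ∀ {A B : Set} (f : A → B → B) (e : B) {m} (g : Fin m → A) →
                 List.foldr f e (List.tabulate g) ≡ Vector.foldr f e g
foldr-tabulate f e {zero}  g = refl
foldr-tabulate f e {suc m} g = cong (f (g zero)) (foldr-tabulate f e (g ∘ suc))

-- Without a preimage of y, punching y out of f would inject Fin (suc m) into Fin m.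
injective⇒surjective : ∀ {m} {f : Fin m → Fin m} → Injective _≡_ _≡_ f → Surjective _≡_ _≡_ f
injective⇒surjective {suc m} {f} f-inj y with any? (λ x → f x ≟ y)
... | yes (x , fx≡y) = x , λ { refl → fx≡y }
... | no ∄x = contradiction (injective⇒≤ punched-injective) 1+n≰n
  where
  punched : Fin (suc m) → Fin m
  punched x = punchOut (λ y≡fx → ∄x (x , sym y≡fx))
  punched-injective : Injective _≡_ _≡_ punched
  punched-injective = f-inj ∘ punchOut-injective {i = y} _ _

injective⇒permutation : ∀ {m} (f : Fin m → Fin m) → Injective _≡_ _≡_ f → Permutation m m
injective⇒permutation f f-inj =
  permutation f (proj₁ ∘ surj) (λ y → proj₂ (surj y) refl) (λ x → f-inj (proj₂ (surj (f x)) refl))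
  where surj = injective⇒surjective f-inj

⌊⌋-⇔ : ∀ {A B : Set} → A ⇔ B → (a? : Dec A) (b? : Dec B) → ⌊ a? ⌋ ≡ ⌊ b? ⌋
⌊⌋-⇔ A⇔B a? b? = trans (isYes≗does a?) (trans (does-⇔ A⇔B a? b?) (sym (isYes≗does b?)))

extendPlane : ∀ {A : Set} {d d'} → d ≤ d' → (Fin d → Maybe A) → Fin d' → Maybe A
extendPlane z≤n     J _       = nothing
extendPlane (s≤s p) J zero    = J zero
extendPlane (s≤s p) J (suc i) = extendPlane p (J ∘ suc) i

countFree-allFree : ∀ {A : Set} d → countFree {d} {A} (λ _ → nothing) ≡ d
countFree-allFree zero    = refl
countFree-allFree (suc d) = cong suc (countFree-allFree d)

countFree-extendPlane : ∀ {A : Set} {d d'} (p : d ≤ d') (J : Fin d → Maybe A) →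
                        countFree (extendPlane p J) ≡ countFree J + (d' ∸ d)
countFree-extendPlane {d' = d'} z≤n J = countFree-allFree d'
countFree-extendPlane (s≤s p) J with J zero
... | nothing = cong suc (countFree-extendPlane p (J ∘ suc))
... | just _  = countFree-extendPlane p (J ∘ suc)

extendPlane-inject≤ : ∀ {A : Set} {d d'} (p : d ≤ d') (J : Fin d → Maybe A) i →
                      extendPlane p J (inject≤ i p) ≡ J i
extendPlane-inject≤ (s≤s p) J zero    = refl
extendPlane-inject≤ (s≤s p) J (suc i) = extendPlane-inject≤ p (J ∘ suc) i

extendPlane≡just⇒ : ∀ {A : Set} {d d'} (p : d ≤ d') (J : Fin d → Maybe A) i {a} →
                    extendPlane p J i ≡ just a → ∃[ i₀ ] inject≤ i₀ p ≡ i × J i₀ ≡ just a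
extendPlane≡just⇒ z≤n     J i       ()
extendPlane≡just⇒ (s≤s p) J zero    J₀≡a = zero , refl , J₀≡a
extendPlane≡just⇒ (s≤s p) J (suc i) eq with extendPlane≡just⇒ p (J ∘ suc) i eq
... | i₀ , refl , J≡a = suc i₀ , refl , J≡a

module Planes {n : ℕ} (_+ᴳ_ : Fin n → Fin n → Fin n) (ε : Fin n) (-ᴳ_ : Fin n → Fin n) where
  open Cube _+ᴳ_ ε -ᴳ_

  extendPlane-isPlane : ∀ {k d d'} (p : d ≤ d') {J : Fin d → Maybe (Fin n)} →
                        IsPlane k J → IsPlane (k + (d' ∸ d)) (extendPlane p J)
  extendPlane-isPlane p {J} refl = countFree-extendPlane p J

  inPlane-extendPlane⇔ : ∀ {d d'} (p : d ≤ d') (J : Fin d → Maybe (Fin n)) (x : Fin d' → Fin n) →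
                         InPlane (extendPlane p J) x ⇔ InPlane J (restrict p x)
  inPlane-extendPlane⇔ p J x = mk⇔
    (λ x∈J' i a Ji≡a → x∈J' (inject≤ i p) a (trans (extendPlane-inject≤ p J i) Ji≡a))
    (λ x∈J i a J'i≡a → case extendPlane≡just⇒ p J i J'i≡a of λ where
      (i₀ , refl , Ji₀≡a) → x∈J i₀ a Ji₀≡a)

module ExtensionTransversals {n : ℕ} (_+ᴳ_ : Fin n → Fin n → Fin n) (ε : Fin n) (-ᴳ_ : Fin n → Fin n)
                             (isAbelianGroup : IsAbelianGroup _≡_ _+ᴳ_ ε -ᴳ_) where
  open IsAbelianGroup isAbelianGroup using (assoc; identityˡ; identityʳ; inverseʳ; isCommutativeMonoid)
  abelianGroup : AbelianGroup _ _
  abelianGroup = record { isAbelianGroup = isAbelianGroup }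
  commutativeMonoid : CommutativeMonoid _ _
  commutativeMonoid = record { isCommutativeMonoid = isCommutativeMonoid }
  open import Algebra.Properties.CommutativeMonoid.Sum commutativeMonoid
    using (sum; sum-cong-≗; ∑-comm; ∑-permute; ∑-distrib-+)
  open import Algebra.Properties.AbelianGroup abelianGroup using (⁻¹-∙-comm; ε⁻¹≈ε)
  open import Algebra.Properties.CommutativeSemigroup (CommutativeMonoid.commutativeSemigroup commutativeMonoid)
    using (interchange)
  open Cube _+ᴳ_ ε -ᴳ_
  open ≡-Reasoning

  Σ[]≡sum : ∀ {m} (f : Fin m → Fin n) → Σ[ f ] ≡ sum f
  Σ[]≡sum f = trans (cong (List.foldr _+ᴳ_ ε) (map-tabulate id f)) (foldr-tabulate _+ᴳ_ ε f)

  sum-⁻¹ : ∀ {m} (f : Fin m → Fin n) → sum (λ j → -ᴳ f j) ≡ -ᴳ sum f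
  sum-⁻¹ {zero}  f = sym ε⁻¹≈ε
  sum-⁻¹ {suc m} f = trans (cong ((-ᴳ f zero) +ᴳ_) (sum-⁻¹ (f ∘ suc))) (⁻¹-∙-comm _ _)

  sum-const : ∀ m c → sum {m} (λ _ → c) ≡ m · c
  sum-const zero    c = refl
  sum-const (suc m) c = cong (c +ᴳ_) (sum-const m c)

  sum-injective≡G₊ : (f : Fin n → Fin n) → Injective _≡_ _≡_ f → sum f ≡ G₊
  sum-injective≡G₊ f f-inj = begin
    sum (π ⟨$⟩ʳ_)  ≡⟨ ∑-permute id π ⟨
    sum id         ≡⟨ Σ[]≡sum id ⟨
    G₊             ∎
    where π = injective⇒permutation f f-inj

  [x+z]-[y+z]≡x-y : ∀ x y z → (x +ᴳ z) +ᴳ (-ᴳ (y +ᴳ z)) ≡ x +ᴳ (-ᴳ y)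
  [x+z]-[y+z]≡x-y x y z = begin
    (x +ᴳ z) +ᴳ (-ᴳ (y +ᴳ z))         ≡⟨ cong ((x +ᴳ z) +ᴳ_) (⁻¹-∙-comm y z) ⟨
    (x +ᴳ z) +ᴳ ((-ᴳ y) +ᴳ (-ᴳ z))    ≡⟨ interchange x z (-ᴳ y) (-ᴳ z) ⟩
    (x +ᴳ (-ᴳ y)) +ᴳ (z +ᴳ (-ᴳ z))    ≡⟨ cong ((x +ᴳ (-ᴳ y)) +ᴳ_) (inverseʳ z) ⟩
    (x +ᴳ (-ᴳ y)) +ᴳ ε                ≡⟨ identityʳ _ ⟩
    x +ᴳ (-ᴳ y)                       ∎

  zeroFirst : ∀ {d'} → ℕ → (Fin d' → Fin n) → Fin d' → Fin n
  zeroFirst d x i = if ⌊ d ≤? toℕ i ⌋ then x i else ε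

  zeroFirst-suc : ∀ {d d'} (x : Fin (suc d') → Fin n) i →
                  zeroFirst (suc d) x (suc i) ≡ zeroFirst d (x ∘ suc) i
  zeroFirst-suc {d} x i =
    cong (λ b → if b then x (suc i) else ε) (⌊⌋-⇔ (mk⇔ s≤s⁻¹ s≤s) (suc d ≤? suc (toℕ i)) (d ≤? toℕ i))

  sum-restrict+zeroFirst : ∀ {d d'} (p : d ≤ d') (x : Fin d' → Fin n) →
                           sum x ≡ sum (restrict p x) +ᴳ sum (zeroFirst d x)
  sum-restrict+zeroFirst z≤n x = sym (identityˡ _)
  sum-restrict+zeroFirst {suc d} (s≤s p) x = begin
    x zero +ᴳ sum (x ∘ suc)
      ≡⟨ cong (x zero +ᴳ_) (sum-restrict+zeroFirst p (x ∘ suc)) ⟩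
    x zero +ᴳ (R +ᴳ Z)
      ≡⟨ assoc _ _ _ ⟨
    (x zero +ᴳ R) +ᴳ Z
      ≡⟨ cong ((x zero +ᴳ R) +ᴳ_) (identityˡ Z) ⟨
    (x zero +ᴳ R) +ᴳ (ε +ᴳ Z)
      ≡⟨ cong (λ s → (x zero +ᴳ R) +ᴳ (ε +ᴳ s)) (sum-cong-≗ (zeroFirst-suc x)) ⟨
    (x zero +ᴳ R) +ᴳ (ε +ᴳ sum (zeroFirst (suc d) x ∘ suc))  ∎
    where
    R = sum (restrict p (x ∘ suc))
    Z = sum (zeroFirst d (x ∘ suc))

  Δ-extension : ∀ {d} d' (p : d ≤ d') (L : Hypercube d) (x : Fin d' → Fin n) →
                Δ (extension d' p L) x ≡ Δ L (restrict p x)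
  Δ-extension {d} d' p L x = begin
    (L r +ᴳ Σ[ zeroFirst d x ]) +ᴳ (-ᴳ Σ[ x ])
      ≡⟨ cong₂ (λ u v → (L r +ᴳ u) +ᴳ (-ᴳ v))
               (Σ[]≡sum (zeroFirst d x)) (trans (Σ[]≡sum x) (sum-restrict+zeroFirst p x)) ⟩
    (L r +ᴳ sum (zeroFirst d x)) +ᴳ (-ᴳ (sum r +ᴳ sum (zeroFirst d x)))
      ≡⟨ [x+z]-[y+z]≡x-y _ _ _ ⟩
    L r +ᴳ (-ᴳ sum r)
      ≡⟨ cong (λ s → L r +ᴳ (-ᴳ s)) (Σ[]≡sum r) ⟨
    L r +ᴳ (-ᴳ Σ[ r ])  ∎
    where r = restrict p x

  diagonal-sum-coordinates : ∀ {d} {D : Fin n → Fin d → Fin n} →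
                             IsDiagonal D → sum (λ j → Σ[ D j ]) ≡ d · G₊
  diagonal-sum-coordinates {d} {D} diag = begin
    sum (λ j → Σ[ D j ])           ≡⟨ sum-cong-≗ (Σ[]≡sum ∘ D) ⟩
    sum (λ j → sum (D j))          ≡⟨ ∑-comm D ⟩
    sum (λ i → sum (λ j → D j i))  ≡⟨ sum-cong-≗ (λ i → sum-injective≡G₊ _ (diag i)) ⟩
    sum {d} (λ _ → G₊)             ≡⟨ sum-const d G₊ ⟩
    d · G₊                         ∎

  transversal⇒suitable : ∀ {d} (H : Hypercube d) {D} → IsTransversal H D → IsSuitable d H D
  transversal⇒suitable {d} H {D} (diag , symbols-injective) = diag , (begin
    Σ[ Δ H ∘ D ]
      ≡⟨ Σ[]≡sum (Δ H ∘ D) ⟩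
    sum (λ j → H (D j) +ᴳ (-ᴳ Σ[ D j ]))
      ≡⟨ ∑-distrib-+ (H ∘ D) (λ j → -ᴳ Σ[ D j ]) ⟩
    sum (H ∘ D) +ᴳ sum (λ j → -ᴳ Σ[ D j ])
      ≡⟨ cong₂ _+ᴳ_ (sum-injective≡G₊ (H ∘ D) symbols-injective) (sum-⁻¹ (λ j → Σ[ D j ])) ⟩
    G₊ +ᴳ (-ᴳ sum (λ j → Σ[ D j ]))
      ≡⟨ cong (λ s → G₊ +ᴳ (-ᴳ s)) (diagonal-sum-coordinates diag) ⟩
    G₊ +ᴳ (-ᴳ (d · G₊))  ∎)

  extension-suitable⇒restrict-suitable : ∀ {d e} d' (p : d ≤ d') (L : Hypercube d) {D'} →
    IsSuitable e (extension d' p L) D' → IsSuitable e L (restrict p ∘ D')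
  extension-suitable⇒restrict-suitable d' p L {D'} (diag , ΣΔ≡) =
    (λ i → diag (inject≤ i p)) , trans ΣΔ-restrict ΣΔ≡
    where
    ΣΔ-restrict : Σ[ Δ L ∘ restrict p ∘ D' ] ≡ Σ[ Δ (extension d' p L) ∘ D' ]
    ΣΔ-restrict = begin
      Σ[ Δ L ∘ restrict p ∘ D' ]       ≡⟨ Σ[]≡sum (Δ L ∘ restrict p ∘ D') ⟩
      sum (Δ L ∘ restrict p ∘ D')      ≡⟨ sum-cong-≗ (Δ-extension d' p L ∘ D') ⟨
      sum (Δ (extension d' p L) ∘ D')  ≡⟨ Σ[]≡sum (Δ (extension d' p L) ∘ D') ⟨
      Σ[ Δ (extension d' p L) ∘ D' ]   ∎

corollary3p3 : (n : ℕ) (_+ᴳ_ : Fin n → Fin n → Fin n) (ε : Fin n) (-ᴳ_ : Fin n → Fin n)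
    → IsAbelianGroup _≡_ _+ᴳ_ ε -ᴳ_
    → let open Cube _+ᴳ_ ε -ᴳ_ in
      (d : ℕ) → 1 ≤ d → (L : Hypercube d) → IsLatin L
    → (d' : ℕ) (d<d' : d < d')
    → (k m : ℕ) (P : Fin m → (Fin d → Maybe (Fin n))) → (∀ i → IsPlane k (P i))
    → (∀ (D : Fin n → (Fin d → Fin n)) → IsSuitable d' L D
         → ∃[ j ] ∃[ i ] InPlane (P i) (D j))
    → (∀ (i : Fin m) → ∃[ J' ] (IsPlane (k + (d' ∸ d)) J'
         × (∀ (x : Fin d' → Fin n) → InPlane J' x ⇔ InPlane (P i) (restrict (<⇒≤ d<d') x))))
      × (∀ (D' : Fin n → (Fin d' → Fin n)) → IsTransversal (extension d' (<⇒≤ d<d') L) D'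
         → ∃[ j ] ∃[ i ] InPlane (P i) (restrict (<⇒≤ d<d') (D' j)))
corollary3p3 n _+ᴳ_ ε -ᴳ_ isAbelianGroup d _ L _ d' d<d' k m P P-isPlane suitable-meets-P =
  (λ i → extendPlane d≤d' (P i) , extendPlane-isPlane d≤d' (P-isPlane i) , inPlane-extendPlane⇔ d≤d' (P i)) ,
  (λ D' D'-transversal → suitable-meets-P (restrict d≤d' ∘ D')
     (extension-suitable⇒restrict-suitable {e = d'} d' d≤d' L
       (transversal⇒suitable (extension d' d≤d' L) D'-transversal)))
  where
  d≤d' : d ≤ d'
  d≤d' = <⇒≤ d<d'
  open Cube _+ᴳ_ ε -ᴳ_ using (restrict; extension)
  open Planes _+ᴳ_ ε -ᴳ_
  open ExtensionTransversals _+ᴳ_ ε -ᴳ_ isAbelianGroup
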